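{- Let $q$ be a prime power and $m\ge2$, $t$ integers with $t\ge q^m+2$, and let $\varepsilon=(t-1)\bmod q$. Define $$R=q^{m+t-1}\frac{q^m-1+(t-1)(q-1)+(-\varepsilon-1)(q-\varepsilon-1)}{(q^m+(q-1)(t-1)+\varepsilon)(q^m+(q-1)(t-1)+\varepsilon-q)}.$$ Then $R\le q^{t-2}$.
   Context: Setting: $\mathbf{n}=(1,\dots,1)$, $\mathbf{m}=(m,1,\dots,1)$ of length $t$, with the sum-rank metric on $\operatorname{Mat}(\mathbf{n},\mathbf{m},\mathbb{F}_q)=\bigoplus_i\mathbb{F}_q^{n_i\times m_i}$. $R$ is the Ratio-Type eigenvalue upper bound on $A_q(\mathbf{n},\mathbf{m},3)$ (largest size of a code with minimum sum-rank distance at least $3$), and $q^{t-2}$ is the value of the Singleton bound for these parameters and $d=3$. The lemma says the Ratio-Type bound is not worse than the Singleton bound. -}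

module Defs where

open import Data.Nat as ℕ using (ℕ; zero; suc)
open import Data.Nat.DivMod using (_%_)
open import Data.Nat.Primality using (Prime)
open import Data.Integer as ℤ using (ℤ; +_; -[1+_]; +0; +[1+_])
open import Data.Rational as ℚ using (ℚ)
open import Data.Product using (∃; _×_)
open import Relation.Binary.PropositionalEquality using (_≡_)

IsPrimePower : ℕ → Set
IsPrimePower q = ∃ λ p → ∃ λ k → Prime p × q ≡ p ℕ.^ suc k

-- natural-number remainder, with the (irrelevant here) convention n mod 0 = n
modℕ : ℕ → ℕ → ℕ
modℕ n zero = n
modℕ n (suc k) = n % suc k

-- division of integers into ℚ, with junk value 0 when the denominator is 0
divℤ : ℤ → ℤ → ℚ
divℤ a +0 = ℚ.0ℚ
divℤ a +[1+ n ] = a ℚ./ suc n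
divℤ a -[1+ n ] = (ℤ.- a) ℚ./ suc n

epsilon : ℕ → ℕ → ℕ
epsilon q t = modℕ (t ℕ.∸ 1) q

ratioR : ℕ → ℕ → ℕ → ℚ
ratioR q m t = divℤ (Q ℤ.^ (m ℕ.+ t ℕ.∸ 1) ℤ.* N) (D₁ ℤ.* D₂)
  where
  Q T E : ℤ
  Q = + q
  T = + t
  E = + epsilon q t
  N : ℤ
  N = (Q ℤ.^ m) ℤ.- ℤ.1ℤ ℤ.+ (T ℤ.- ℤ.1ℤ) ℤ.* (Q ℤ.- ℤ.1ℤ)
      ℤ.+ (ℤ.- E ℤ.- ℤ.1ℤ) ℤ.* (Q ℤ.- E ℤ.- ℤ.1ℤ)
  D₁ D₂ : ℤ
  D₁ = (Q ℤ.^ m) ℤ.+ (Q ℤ.- ℤ.1ℤ) ℤ.* (T ℤ.- ℤ.1ℤ) ℤ.+ E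
  D₂ = D₁ ℤ.- Q

{-# OPTIONS --safe #-}
-- Clearing denominators, and using q^(m+t-1) = q^(t-2) · q · q^m, the claim R ≤ q^(t-2)
-- reduces to q · q^m · N ≤ D₁ D₂ with D₁ D₂ > 0.  Write q = 1 + ε + r, q^m = 1 + a and
-- t = q^m + 2 + u with a, r, u ≥ 0 (r ≥ 0 because ε < q).  Then D₂ = a + (q-1)(q^m+u) + ε,
-- which is positive since q ≥ 2, D₁ = D₂ + q, and the difference D₁ D₂ - q · q^m · N is a
-- polynomial in a, ε, r, u with nonnegative coefficients.
module Submission where

open import Defs
open import Data.Nat using (ℕ; _+_; _^_; _∸_; _≤_)
open import Data.Integer using (+_)
open import Data.Rational using (_/_) renaming (_≤_ to _≤ℚ_)

open import Data.Nat as ℕ using (zero; suc; _<_; s≤s; z≤n)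
import Data.Nat.Properties as ℕP
open import Data.Nat.DivMod using (m%n<n)
open import Data.Nat.Primality using (prime⇒nonTrivial)
open import Data.Integer as ℤ using (ℤ; 0ℤ; 1ℤ; +[1+_]; +≤+; +<+)
import Data.Integer.Properties as ℤP
open import Data.Integer.Tactic.RingSolver using (solve-∀)
import Data.Rational as ℚ
import Data.Rational.Properties as ℚP
import Data.Rational.Unnormalised as ℚᵘ
import Data.Rational.Unnormalised.Properties as ℚᵘP
open import Data.Product using (_×_; _,_; proj₁; proj₂)
open import Relation.Binary.PropositionalEquality

primePower⇒2≤ : ∀ {q} → IsPrimePower q → 2 ≤ q
primePower⇒2≤ (p , k , p-prime , refl) = ℕP.*-mono-≤ 1<p (ℕP.m^n>0 p {{ℕ.>-nonZero 0<p}} k)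
  where
  1<p : 1 < p
  1<p = ℕ.nonTrivial⇒n>1 p {{prime⇒nonTrivial p-prime}}
  0<p : 0 < p
  0<p = ℕP.<-trans (s≤s z≤n) 1<p

epsilon<q : ∀ q t → 0 < q → epsilon q t < q
epsilon<q (suc k) t _ = m%n<n (t ∸ 1) (suc k)

pos-^ : ∀ m n → + (m ^ n) ≡ (+ m) ℤ.^ n
pos-^ m zero    = refl
pos-^ m (suc n) = trans (ℤP.pos-* m (m ^ n)) (cong (+ m ℤ.*_) (pos-^ m n))

^-split : ∀ (i : ℤ) m {t} → 2 ≤ t → i ℤ.^ (m + t ∸ 1) ≡ i ℤ.^ (t ∸ 2) ℤ.* (i ℤ.* i ℤ.^ m)
^-split i m {suc (suc t)} _ = begin
  i ℤ.^ (m + suc (suc t) ∸ 1)  ≡⟨ cong (λ k → i ℤ.^ (k ∸ 1)) (ℕP.+-suc m (suc t)) ⟩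
  i ℤ.^ (m + suc t)            ≡⟨ cong (i ℤ.^_) (ℕP.+-comm m (suc t)) ⟩
  i ℤ.^ suc (t + m)            ≡⟨ cong (i ℤ.^_) (sym (ℕP.+-suc t m)) ⟩
  i ℤ.^ (t + suc m)            ≡⟨ ℤP.^-distribˡ-+-* i t (suc m) ⟩
  i ℤ.^ t ℤ.* i ℤ.^ suc m      ∎
  where open ≡-Reasoning
^-split i m {suc zero} (s≤s ())

fromℚᵘ-mono-≤ : ∀ {p q} → p ℚᵘ.≤ q → ℚ.fromℚᵘ p ℚ.≤ ℚ.fromℚᵘ q
fromℚᵘ-mono-≤ {p} {q} p≤q = ℚP.toℚᵘ-cancel-≤
  (ℚᵘP.≤-respˡ-≃ (ℚᵘP.≃-sym (ℚP.toℚᵘ-fromℚᵘ p))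
    (ℚᵘP.≤-respʳ-≃ (ℚᵘP.≃-sym (ℚP.toℚᵘ-fromℚᵘ q)) p≤q))

divℤ-≤ : ∀ c {A X B} → A ≡ + c ℤ.* X → 0ℤ ℤ.< B → X ℤ.≤ B → divℤ A B ≤ℚ (+ c / 1)
divℤ-≤ c {X = X} {B = +[1+ b ]} refl _ X≤B =
  fromℚᵘ-mono-≤ {ℚᵘ.mkℚᵘ (+ c ℤ.* X) b} {ℚᵘ.mkℚᵘ (+ c) 0} (ℚᵘ.*≤* (begin
    (+ c ℤ.* X) ℤ.* 1ℤ  ≡⟨ ℤP.*-identityʳ (+ c ℤ.* X) ⟩
    + c ℤ.* X           ≤⟨ ℤP.*-monoˡ-≤-nonNeg (+ c) X≤B ⟩
    + c ℤ.* +[1+ b ]    ∎))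
  where open ℤP.≤-Reasoning
divℤ-≤ c {B = + 0} _ (+<+ ())

0<1 : 0ℤ ℤ.< 1ℤ
0<1 = +<+ (s≤s z≤n)

+-nonNeg : ∀ {i j} → 0ℤ ℤ.≤ i → 0ℤ ℤ.≤ j → 0ℤ ℤ.≤ i ℤ.+ j
+-nonNeg = ℤP.+-mono-≤

*-nonNeg : ∀ {i j} → 0ℤ ℤ.≤ i → 0ℤ ℤ.≤ j → 0ℤ ℤ.≤ i ℤ.* j
*-nonNeg {+ m} {+ n} _ _ = subst (0ℤ ℤ.≤_) (ℤP.pos-* m n) (+≤+ z≤n)

*-pos : ∀ {i j} → 0ℤ ℤ.< i → 0ℤ ℤ.< j → 0ℤ ℤ.< i ℤ.* j
*-pos (+<+ (s≤s z≤n)) (+<+ (s≤s z≤n)) = +<+ (s≤s z≤n)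

-- The factors of ratioR q m t, which unfolds to
-- divℤ (Q ^ (m + t ∸ 1) * numerator Q T E M) (denominator₁ Q T E M * denominator₂ Q T E M)
-- for Q = + q, T = + t, E = + epsilon q t and M = Q ^ m.
numerator denominator₁ denominator₂ : ℤ → ℤ → ℤ → ℤ → ℤ
numerator Q T E M =
  M ℤ.- 1ℤ ℤ.+ (T ℤ.- 1ℤ) ℤ.* (Q ℤ.- 1ℤ) ℤ.+ (ℤ.- E ℤ.- 1ℤ) ℤ.* (Q ℤ.- E ℤ.- 1ℤ)
denominator₁ Q T E M = M ℤ.+ (Q ℤ.- 1ℤ) ℤ.* (T ℤ.- 1ℤ) ℤ.+ E
denominator₂ Q T E M = denominator₁ Q T E M ℤ.- Q

-- denominator₂ and the excess of denominator₁ * denominator₂ over Q * M * numerator,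
-- in the coordinates Q = 1 + E + R, M = 1 + A, T = M + 2 + U.
shiftedDenominator denominatorExcess : ℤ → ℤ → ℤ → ℤ → ℤ
shiftedDenominator A E R U = A ℤ.+ (E ℤ.+ R) ℤ.* (1ℤ ℤ.+ A ℤ.+ U) ℤ.+ E
denominatorExcess A E R U =
  (shiftedDenominator A E R U ℤ.+ E ℤ.+ R) ℤ.* ((E ℤ.+ R) ℤ.* U ℤ.+ E)
  ℤ.+ (E ℤ.+ R) ℤ.* ((E ℤ.+ R) ℤ.* (1ℤ ℤ.+ A) ℤ.+ A)
  ℤ.+ (1ℤ ℤ.+ E ℤ.+ R) ℤ.* (1ℤ ℤ.+ A) ℤ.* E ℤ.* R

-- solve-∀ does not unfold definitions, so each identity is restated with them inlined.
denominators-shifted : ∀ {Q T E M A R U} →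
  Q ≡ 1ℤ ℤ.+ E ℤ.+ R → M ≡ 1ℤ ℤ.+ A → T ≡ M ℤ.+ + 2 ℤ.+ U →
  denominator₁ Q T E M ℤ.* denominator₂ Q T E M
  ≡ (shiftedDenominator A E R U ℤ.+ Q) ℤ.* shiftedDenominator A E R U
denominators-shifted {E = E} {A = A} {R = R} {U = U} refl refl refl = inlined A E R U
  where
  inlined : ∀ A E R U →
    let Q = 1ℤ ℤ.+ E ℤ.+ R ; M = 1ℤ ℤ.+ A ; T = M ℤ.+ + 2 ℤ.+ U
        D₁ = M ℤ.+ (Q ℤ.- 1ℤ) ℤ.* (T ℤ.- 1ℤ) ℤ.+ E
        S = A ℤ.+ (E ℤ.+ R) ℤ.* (1ℤ ℤ.+ A ℤ.+ U) ℤ.+ E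
    in D₁ ℤ.* (D₁ ℤ.- Q) ≡ (S ℤ.+ Q) ℤ.* S
  inlined = solve-∀

denominators-excess : ∀ {Q T E M A R U} →
  Q ≡ 1ℤ ℤ.+ E ℤ.+ R → M ≡ 1ℤ ℤ.+ A → T ≡ M ℤ.+ + 2 ℤ.+ U →
  denominator₁ Q T E M ℤ.* denominator₂ Q T E M
  ≡ Q ℤ.* M ℤ.* numerator Q T E M ℤ.+ denominatorExcess A E R U
denominators-excess {E = E} {A = A} {R = R} {U = U} refl refl refl = inlined A E R U
  where
  inlined : ∀ A E R U →
    let Q = 1ℤ ℤ.+ E ℤ.+ R ; M = 1ℤ ℤ.+ A ; T = M ℤ.+ + 2 ℤ.+ U
        D₁ = M ℤ.+ (Q ℤ.- 1ℤ) ℤ.* (T ℤ.- 1ℤ) ℤ.+ E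
        N = M ℤ.- 1ℤ ℤ.+ (T ℤ.- 1ℤ) ℤ.* (Q ℤ.- 1ℤ) ℤ.+ (ℤ.- E ℤ.- 1ℤ) ℤ.* (Q ℤ.- E ℤ.- 1ℤ)
        S = A ℤ.+ (E ℤ.+ R) ℤ.* (1ℤ ℤ.+ A ℤ.+ U) ℤ.+ E
    in D₁ ℤ.* (D₁ ℤ.- Q) ≡ Q ℤ.* M ℤ.* N ℤ.+
       ((S ℤ.+ E ℤ.+ R) ℤ.* ((E ℤ.+ R) ℤ.* U ℤ.+ E)
        ℤ.+ (E ℤ.+ R) ℤ.* ((E ℤ.+ R) ℤ.* (1ℤ ℤ.+ A) ℤ.+ A)
        ℤ.+ Q ℤ.* M ℤ.* E ℤ.* R)
  inlined = solve-∀

shiftedDenominator-pos : ∀ {A E R U} → 0ℤ ℤ.≤ A → 0ℤ ℤ.≤ E → 0ℤ ℤ.≤ U →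
  0ℤ ℤ.< E ℤ.+ R → 0ℤ ℤ.< shiftedDenominator A E R U
shiftedDenominator-pos 0≤A 0≤E 0≤U 0<E+R =
  ℤP.+-mono-<-≤ (ℤP.+-mono-≤-< 0≤A (*-pos 0<E+R 0<1+A+U)) 0≤E
  where
  0<1+A+U = ℤP.+-mono-<-≤ (ℤP.+-mono-<-≤ 0<1 0≤A) 0≤U

denominatorExcess-nonNeg : ∀ {A E R U} → 0ℤ ℤ.≤ A → 0ℤ ℤ.≤ E → 0ℤ ℤ.≤ R → 0ℤ ℤ.≤ U →
  0ℤ ℤ.< E ℤ.+ R → 0ℤ ℤ.≤ denominatorExcess A E R U
denominatorExcess-nonNeg {R = R} 0≤A 0≤E 0≤R 0≤U 0<E+R =
  +-nonNeg (+-nonNeg (*-nonNeg (+-nonNeg (+-nonNeg 0≤S 0≤E) 0≤R) (+-nonNeg (*-nonNeg 0≤E+R 0≤U) 0≤E))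
                     (*-nonNeg 0≤E+R (+-nonNeg (*-nonNeg 0≤E+R 0≤M) 0≤A)))
           (*-nonNeg (*-nonNeg (*-nonNeg (+-nonNeg (+-nonNeg 0≤1 0≤E) 0≤R) 0≤M) 0≤E) 0≤R)
  where
  0≤1 = ℤP.<⇒≤ 0<1
  0≤E+R = ℤP.<⇒≤ 0<E+R
  0≤M = +-nonNeg 0≤1 0≤A
  0≤S = ℤP.<⇒≤ (shiftedDenominator-pos {R = R} 0≤A 0≤E 0≤U 0<E+R)

denominators-bound : ∀ {Q T E M A R U} → 0ℤ ℤ.≤ A → 0ℤ ℤ.≤ E → 0ℤ ℤ.≤ R → 0ℤ ℤ.≤ U →
  0ℤ ℤ.< E ℤ.+ R → Q ≡ 1ℤ ℤ.+ E ℤ.+ R → M ≡ 1ℤ ℤ.+ A → T ≡ M ℤ.+ + 2 ℤ.+ U →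
  0ℤ ℤ.< denominator₁ Q T E M ℤ.* denominator₂ Q T E M
  × Q ℤ.* M ℤ.* numerator Q T E M ℤ.≤ denominator₁ Q T E M ℤ.* denominator₂ Q T E M
denominators-bound {Q} {T} {E} {M} {A} {R} {U} 0≤A 0≤E 0≤R 0≤U 0<E+R Q≡ M≡ T≡ =
  subst (0ℤ ℤ.<_) (sym (denominators-shifted {A = A} Q≡ M≡ T≡)) (*-pos (ℤP.+-mono-<-≤ 0<S 0≤Q) 0<S) ,
  subst (QMN ℤ.≤_) (sym (denominators-excess {A = A} Q≡ M≡ T≡))
    (ℤP.i≤i+j QMN (denominatorExcess A E R U)
      {{ℤ.nonNegative (denominatorExcess-nonNeg 0≤A 0≤E 0≤R 0≤U 0<E+R)}})
  where
  QMN = Q ℤ.* M ℤ.* numerator Q T E M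
  0<S = shiftedDenominator-pos {R = R} 0≤A 0≤E 0≤U 0<E+R
  0≤Q = subst (0ℤ ℤ.≤_) (sym Q≡) (+-nonNeg (+-nonNeg (ℤP.<⇒≤ 0<1) 0≤E) 0≤R)

numerator≤denominators : ∀ {q m t e} → 2 ≤ q → e < q → q ^ m + 2 ≤ t →
  let Q = + q ; T = + t ; E = + e ; M = Q ℤ.^ m in
  0ℤ ℤ.< denominator₁ Q T E M ℤ.* denominator₂ Q T E M
  × Q ℤ.* M ℤ.* numerator Q T E M ℤ.≤ denominator₁ Q T E M ℤ.* denominator₂ Q T E M
numerator≤denominators {q} {m} {t} {e} 2≤q e<q q^m+2≤t
  with r , 1+e+r≡q ← ℕP.m≤n⇒∃[o]m+o≡n e<q
     | a , 1+a≡q^m ← ℕP.m≤n⇒∃[o]m+o≡n (ℕP.m^n>0 q {{ℕ.>-nonZero (ℕP.<-trans (s≤s z≤n) 2≤q)}} m)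
     | u , q^m+2+u≡t ← ℕP.m≤n⇒∃[o]m+o≡n q^m+2≤t
  = denominators-bound {A = + a} {R = + r} {U = + u} (+≤+ z≤n) (+≤+ z≤n) (+≤+ z≤n) (+≤+ z≤n)
      (+<+ (ℕ.s≤s⁻¹ (subst (2 ≤_) (sym 1+e+r≡q) 2≤q)))
      (cong +_ (sym 1+e+r≡q))
      (trans (sym (pos-^ q m)) (cong +_ (sym 1+a≡q^m)))
      (trans (cong +_ (sym q^m+2+u≡t)) (cong (λ M → M ℤ.+ + 2 ℤ.+ + u) (pos-^ q m)))

lemma5p3 : (q m t : ℕ) → IsPrimePower q → 2 ≤ m → q ^ m + 2 ≤ t →
    ratioR q m t ≤ℚ ((+ (q ^ (t ∸ 2))) / 1)
lemma5p3 q m t q-primePower _ q^m+2≤t =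
  divℤ-≤ (q ^ (t ∸ 2)) power-split (proj₁ bounds) (proj₂ bounds)
  where
  open ≡-Reasoning
  Q = + q
  N = numerator Q (+ t) (+ epsilon q t) (Q ℤ.^ m)
  2≤q = primePower⇒2≤ q-primePower
  2≤t = ℕP.≤-trans (ℕP.m≤n+m 2 (q ^ m)) q^m+2≤t
  bounds = numerator≤denominators {m = m} 2≤q (epsilon<q q t (ℕP.<-trans (s≤s z≤n) 2≤q)) q^m+2≤t
  power-split : Q ℤ.^ (m + t ∸ 1) ℤ.* N ≡ + (q ^ (t ∸ 2)) ℤ.* (Q ℤ.* Q ℤ.^ m ℤ.* N)
  power-split = begin
    Q ℤ.^ (m + t ∸ 1) ℤ.* N                ≡⟨ cong (ℤ._* N) (^-split Q m 2≤t) ⟩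
    Q ℤ.^ (t ∸ 2) ℤ.* (Q ℤ.* Q ℤ.^ m) ℤ.* N ≡⟨ ℤP.*-assoc (Q ℤ.^ (t ∸ 2)) (Q ℤ.* Q ℤ.^ m) N ⟩
    Q ℤ.^ (t ∸ 2) ℤ.* (Q ℤ.* Q ℤ.^ m ℤ.* N) ≡⟨ cong (ℤ._* (Q ℤ.* Q ℤ.^ m ℤ.* N)) (sym (pos-^ q (t ∸ 2))) ⟩
    + (q ^ (t ∸ 2)) ℤ.* (Q ℤ.* Q ℤ.^ m ℤ.* N) ∎
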